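{- Let $U$ be a finite set, $\mu$ a closure operator on $2^U$ (identified with the set of pairs $\{(S,S\mu):S\subseteq U\}$), let $\alpha\subseteq\mu$ and $\beta\subseteq\mu$ be nonredundant covers of $\mu$, and let $C$ be a closed set of $\mu$. Then $\alpha_{=C}=\emptyset$ if and only if $\beta_{=C}=\emptyset$.
   Context: A closure operator on $2^U$ is a map $\mu:2^U\to2^U$, written $X\mapsto X\mu$, with $X\subseteq X\mu$, $X\subseteq Y\Rightarrow X\mu\subseteq Y\mu$, $X\mu\mu=X\mu$; $C$ is closed if $C\mu=C$. Extension by closure: for a function $\alpha$ (a set of pairs $(S,T)$ of subsets of $U$, at most one pair per $S$) and $X\subseteq U$, put $X\alpha_0=X$, $X\alpha_{t+1}=X\alpha_t\cup\bigcup\{T:(S,T)\in\alpha,\ S\subseteq X\alpha_t\}$; the sequence stabilizes and $X\alpha^+$ is its final value; $\alpha^+$ is $X\mapsto X\alpha^+$. A subset $\alpha\subseteq\mu$ is a cover of $\mu$ if $\alpha^+=\mu$; a cover $\alpha$ is nonredundant if no proper subset $\beta\subsetneq\alpha$ satisfies $\beta^+=\alpha^+$. For $\alpha\subseteq\mu$ and a closed set $C$, the top of $\alpha$ at $C$ is $\alpha_{=C}=\{(S,S\mu)\in\alpha : S\mu=C\}$. -}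

module Defs where

open import Data.Nat using (ℕ; zero; suc; _≤_)
open import Data.Bool using (Bool; true; false; T; T?)
open import Data.Fin using (Fin)
open import Data.Fin.Subset using (Subset; _⊆_; _∪_; ⋃; inside; outside; _∈_)
open import Data.Fin.Subset.Properties using (_⊆?_)
open import Data.List using (List; []; _∷_; map; _++_; filter)
open import Data.Vec using ([])
open import Data.Product using (Σ; ∃; _×_; _,_)
open import Relation.Nullary using (¬_)
open import Relation.Nullary.Decidable using (_×-dec_)
open import Relation.Binary.PropositionalEquality using (_≡_; _≢_)

-- The finite ground set U is Fin n; subsets of U are Subset n (= Vec Bool n).

record IsClosureOperator {n : ℕ} (μ : Subset n → Subset n) : Set where
  field
    extensive  : ∀ X → X ⊆ μ X
    monotone   : ∀ {X Y} → X ⊆ Y → μ X ⊆ μ Y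
    idempotent : ∀ X → μ (μ X) ≡ μ X

Closed : {n : ℕ} → (Subset n → Subset n) → Subset n → Set
Closed μ C = μ C ≡ C

allSubsets : (n : ℕ) → List (Subset n)
allSubsets zero = [] ∷ []
allSubsets (suc n) = map (outside ∷_) (allSubsets n) ++ map (inside ∷_) (allSubsets n)
  where open Data.Vec using (_∷_)

-- A subset α ⊆ μ (a function: at most one pair per S, and every pair is (S, Sμ))
-- is determined by its domain; we represent it by the characteristic
-- function of its domain: (S , Sμ) ∈ α  iff  T (α S).
SubRel : ℕ → Set
SubRel n = Subset n → Bool

step : {n : ℕ} → (Subset n → Subset n) → SubRel n → Subset n → Subset n
step {n} μ α X =
  X ∪ ⋃ (map μ (filter (λ S → T? (α S) ×-dec (S ⊆? X)) (allSubsets n)))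

iter : {n : ℕ} → (Subset n → Subset n) → SubRel n → ℕ → Subset n → Subset n
iter μ α zero X = X
iter μ α (suc t) X = step μ α (iter μ α t X)

PlusIs : {n : ℕ} → (Subset n → Subset n) → SubRel n → Subset n → Subset n → Set
PlusIs μ α X Y = ∃ λ t → ∀ s → t ≤ s → iter μ α s X ≡ Y

SamePlus : {n : ℕ} → (Subset n → Subset n) → SubRel n → SubRel n → Set
SamePlus {n} μ α β = ∀ (X Y : Subset n) → (PlusIs μ α X Y → PlusIs μ β X Y) × (PlusIs μ β X Y → PlusIs μ α X Y)

IsCover : {n : ℕ} → (Subset n → Subset n) → SubRel n → Set
IsCover μ α = ∀ X → PlusIs μ α X (μ X)

ProperSub : {n : ℕ} → SubRel n → SubRel n → Set
ProperSub {n} β α = (∀ S → T (β S) → T (α S)) × (∃ λ (S : Subset n) → T (α S) × ¬ T (β S))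

Nonredundant : {n : ℕ} → (Subset n → Subset n) → SubRel n → Set
Nonredundant μ α = ∀ β → ProperSub β α → ¬ SamePlus μ β α

TopEmpty : {n : ℕ} → (Subset n → Subset n) → SubRel n → Subset n → Set
TopEmpty μ α C = ∀ S → T (α S) → μ S ≢ C

{-# OPTIONS --safe #-}
-- Call a set Z stable under α when S ⊆ Z and (S , Sμ) ∈ α imply Sμ ⊆ Z.  X α⁺ is the
-- least α-stable set containing X, so α⁺ depends only on the α-stable sets.  Suppose
-- α_{=C} = ∅ but (S , C) ∈ β.  If Z is stable under β without S and S ⊆ Z, then Z ∩ C
-- is closed under every Tμ ⊊ C with T ⊆ Z ∩ C (as Z ∩ Tμ is β-stable), hence α-stable,
-- since α only adds such sets below C; so C = Sμ ⊆ Z.  Thus dropping (S , C) leaves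
-- the stable sets, and so β⁺, unchanged, contradicting nonredundancy of β.
module Submission where

open import Defs
open import Data.Nat using (ℕ; zero; suc; _<_; _+_; _≤′_; ≤′-reflexive; ≤′-step)
open import Data.Nat.Properties
  using (≤-refl; ≤-trans; ≤-reflexive; <-≤-trans; <⇒≱; +-suc; +-identityʳ; +-monoˡ-≤; m≤n+m; n≤1+n; ≤⇒≤′)
open import Data.Fin using (Fin)
open import Data.Fin.Subset using (Subset; _⊆_; _∪_; _∩_; ⋃; _∈_; ∣_∣)
open import Data.Fin.Subset.Properties
  using (∉⊥; x∈p∪q⁻; p⊆p∪q; q⊆p∪q; x∈p∩q⁺; p∩q⊆p; p∩q⊆q; ⊆-trans; ⊆-antisym; _∈?_; _⊆?_; _⊂?_; p⊂q⇒∣p∣<∣q∣; ∣p∣≤n)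
open import Data.Bool using (true; false; T; T?; if_then_else_)
import Data.Bool as Bool
open import Data.List using (List; []; _∷_; map; filter)
import Data.List.Membership.Propositional as List
open import Data.List.Membership.Propositional.Properties
  using (∈-map⁺; ∈-map⁻; ∈-filter⁺; ∈-filter⁻; ∈-++⁺ˡ; ∈-++⁺ʳ)
open import Data.List.Relation.Unary.Any using (here; there)
open import Data.Vec using (_∷_; [])
open import Data.Vec.Properties using (≡-dec)
open import Data.Product using (∃; _×_; _,_)
open import Data.Sum using (inj₁; inj₂)
open import Data.Empty using (⊥-elim)
open import Relation.Nullary using (¬_; Dec; yes; no; does; contradiction)
open import Relation.Nullary.Decidable using (_×-dec_)
open import Relation.Binary.PropositionalEquality using (_≡_; _≢_; refl; sym; trans; cong; subst)

private
  variable
    n : ℕ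

_≟ₛ_ : (A B : Subset n) → Dec (A ≡ B)
_≟ₛ_ = ≡-dec Bool._≟_

⊆-∩ : {X A B : Subset n} → X ⊆ A → X ⊆ B → X ⊆ A ∩ B
⊆-∩ X⊆A X⊆B x∈X = x∈p∩q⁺ (X⊆A x∈X , X⊆B x∈X)

x∈⋃⁻ : {x : Fin n} (As : List (Subset n)) → x ∈ ⋃ As → ∃ λ A → A List.∈ As × x ∈ A
x∈⋃⁻ []       x∈⋃ = ⊥-elim (∉⊥ x∈⋃)
x∈⋃⁻ (A ∷ As) x∈⋃ with x∈p∪q⁻ A (⋃ As) x∈⋃
... | inj₁ x∈A = A , here refl , x∈A
... | inj₂ x∈⋃As with x∈⋃⁻ As x∈⋃As
...   | B , B∈As , x∈B = B , there B∈As , x∈B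

∈⇒⊆⋃ : {A : Subset n} (As : List (Subset n)) → A List.∈ As → A ⊆ ⋃ As
∈⇒⊆⋃ (A ∷ As) (here refl)  = p⊆p∪q (⋃ As)
∈⇒⊆⋃ (B ∷ As) (there A∈As) = ⊆-trans (∈⇒⊆⋃ As A∈As) (q⊆p∪q B (⋃ As))

∈-allSubsets : (S : Subset n) → S List.∈ allSubsets n
∈-allSubsets []            = here refl
∈-allSubsets (false ∷ S)   = ∈-++⁺ˡ (∈-map⁺ (false ∷_) (∈-allSubsets S))
∈-allSubsets {suc n} (true ∷ S) =
  ∈-++⁺ʳ (map (false ∷_) (allSubsets n)) (∈-map⁺ (true ∷_) (∈-allSubsets S))

module Extension (μ : Subset n → Subset n) where

  Stable : SubRel n → Subset n → Set
  Stable α Z = ∀ S → T (α S) → S ⊆ Z → μ S ⊆ Z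

  record IsLeastStableAbove (α : SubRel n) (X Y : Subset n) : Set where
    field
      above  : X ⊆ Y
      stable : Stable α Y
      least  : ∀ {Z} → X ⊆ Z → Stable α Z → Y ⊆ Z

  module _ (α : SubRel n) where

    private
      applicable? : (W S : Subset n) → Dec (T (α S) × S ⊆ W)
      applicable? W S = T? (α S) ×-dec (S ⊆? W)

      generated : Subset n → List (Subset n)
      generated W = map μ (filter (applicable? W) (allSubsets n))

    step-inflationary : ∀ X → X ⊆ step μ α X
    step-inflationary X = p⊆p∪q _

    iter-inflationary : ∀ t X → X ⊆ iter μ α t X
    iter-inflationary zero    X = λ x∈X → x∈X
    iter-inflationary (suc t) X = ⊆-trans (iter-inflationary t X) (step-inflationary _)

    fixed⇒stable : ∀ Y → step μ α Y ≡ Y → Stable α Y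
    fixed⇒stable Y fixed S αS S⊆Y =
      subst (μ S ⊆_) fixed
        (⊆-trans (∈⇒⊆⋃ (generated Y) (∈-map⁺ μ (∈-filter⁺ (applicable? Y) (∈-allSubsets S) (αS , S⊆Y))))
                 (q⊆p∪q Y _))

    step-least : ∀ {W Z} → W ⊆ Z → Stable α Z → step μ α W ⊆ Z
    step-least {W} W⊆Z stableZ {x} x∈step with x∈p∪q⁻ W _ x∈step
    ... | inj₁ x∈W = W⊆Z x∈W
    ... | inj₂ x∈⋃ with x∈⋃⁻ (generated W) x∈⋃
    ...   | _ , A∈gen , x∈A with ∈-map⁻ μ {xs = filter (applicable? W) (allSubsets n)} A∈gen
    ...     | S , S∈filter , refl with ∈-filter⁻ (applicable? W) {xs = allSubsets n} S∈filter
    ...       | _ , αS , S⊆W = stableZ S αS (⊆-trans S⊆W W⊆Z) x∈A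

    iter-least : ∀ t {X Z} → X ⊆ Z → Stable α Z → iter μ α t X ⊆ Z
    iter-least zero    X⊆Z stableZ = X⊆Z
    iter-least (suc t) X⊆Z stableZ = step-least (iter-least t X⊆Z stableZ) stableZ

    iter-step : ∀ t X → iter μ α t (step μ α X) ≡ iter μ α (suc t) X
    iter-step zero    X = refl
    iter-step (suc t) X = cong (step μ α) (iter-step t X)

    iter-stays : ∀ {t s X} → step μ α (iter μ α t X) ≡ iter μ α t X → t ≤′ s → iter μ α s X ≡ iter μ α t X
    iter-stays fixed (≤′-reflexive refl) = refl
    iter-stays fixed (≤′-step t≤′s)      = trans (cong (step μ α) (iter-stays fixed t≤′s)) fixed

    step-grows : ∀ X → step μ α X ≢ X → ∣ X ∣ < ∣ step μ α X ∣
    step-grows X notFixed with X ⊂? step μ α X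
    ... | yes X⊂step = p⊂q⇒∣p∣<∣q∣ X⊂step
    ... | no  X⊄step = contradiction (⊆-antisym step⊆X (step-inflationary X)) notFixed
      where
      step⊆X : step μ α X ⊆ X
      step⊆X {x} x∈step with x ∈? X
      ... | yes x∈X = x∈X
      ... | no  x∉X = ⊥-elim (X⊄step (step-inflationary X , x , x∈step , x∉X))

    -- Invariant n < ∣ X ∣ + k: fewer than k elements can still be added, and every non-final step adds one.
    fixpoint-within : ∀ k X → n < ∣ X ∣ + k → ∃ λ t → step μ α (iter μ α t X) ≡ iter μ α t X
    fixpoint-within zero    X n<∣X∣+0 = contradiction (∣p∣≤n X) (<⇒≱ (subst (n <_) (+-identityʳ ∣ X ∣) n<∣X∣+0))
    fixpoint-within (suc k) X n<∣X∣+k+1 with step μ α X ≟ₛ X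
    ... | yes fixed   = 0 , fixed
    ... | no notFixed with fixpoint-within k (step μ α X)
                             (<-≤-trans n<∣X∣+k+1 (≤-trans (≤-reflexive (+-suc ∣ X ∣ k)) (+-monoˡ-≤ k (step-grows X notFixed))))
    ...   | t , fixed = suc t , subst (λ W → step μ α W ≡ W) (iter-step t X) fixed

    plusIs-exists : ∀ X → ∃ λ Y → PlusIs μ α X Y
    plusIs-exists X with fixpoint-within (suc n) X (m≤n+m (suc n) ∣ X ∣)
    ... | t , fixed = iter μ α t X , t , λ s t≤s → iter-stays fixed (≤⇒≤′ t≤s)

    plusIs⇒leastStableAbove : ∀ {X Y} → PlusIs μ α X Y → IsLeastStableAbove α X Y
    plusIs⇒leastStableAbove {X} {Y} (t , stays) = record
      { above  = subst (X ⊆_) Yₜ (iter-inflationary t X)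
      ; stable = fixed⇒stable Y (trans (cong (step μ α) (sym Yₜ)) (stays (suc t) (n≤1+n t)))
      ; least  = λ X⊆Z stableZ → subst (_⊆ _) Yₜ (iter-least t X⊆Z stableZ)
      }
      where
      Yₜ : iter μ α t X ≡ Y
      Yₜ = stays t ≤-refl

    cover⇒closure-least : IsCover μ α → ∀ {X Z} → Stable α Z → X ⊆ Z → μ X ⊆ Z
    cover⇒closure-least cover {X} stableZ X⊆Z =
      IsLeastStableAbove.least (plusIs⇒leastStableAbove (cover X)) X⊆Z stableZ

  samePlus-of-sameStable : ∀ α β → (∀ {Z} → Stable α Z → Stable β Z) → (∀ {Z} → Stable β Z → Stable α Z) →
    SamePlus μ α β
  samePlus-of-sameStable α β α⇒β β⇒α X Y = transfer α β α⇒β β⇒α , transfer β α β⇒α α⇒β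
    where
    transfer : ∀ γ δ → (∀ {Z} → Stable γ Z → Stable δ Z) → (∀ {Z} → Stable δ Z → Stable γ Z) →
      PlusIs μ γ X Y → PlusIs μ δ X Y
    transfer γ δ γ⇒δ δ⇒γ γ⁺ with plusIs-exists δ X
    ... | Y′ , δ⁺ = subst (PlusIs μ δ X) (⊆-antisym (L′.least L.above (γ⇒δ L.stable)) (L.least L′.above (δ⇒γ L′.stable))) δ⁺
      where
      module L  = IsLeastStableAbove (plusIs⇒leastStableAbove γ γ⁺)
      module L′ = IsLeastStableAbove (plusIs⇒leastStableAbove δ δ⁺)

module ClosureCovers {μ : Subset n → Subset n} (closure : IsClosureOperator μ) where

  open IsClosureOperator closure
  open Extension μ

  closure-least : ∀ {X D} → Closed μ D → X ⊆ D → μ X ⊆ D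
  closure-least closedD X⊆D = subst (_ ⊆_) closedD (monotone X⊆D)

  without : SubRel n → Subset n → SubRel n
  without β S S′ = if does (S′ ≟ₛ S) then false else β S′

  without-⊆ : ∀ β S S′ → T (without β S S′) → T (β S′)
  without-⊆ β S S′ p with S′ ≟ₛ S
  ... | no _ = p

  without-keeps : ∀ β {S S′} → S′ ≢ S → T (β S′) → T (without β S S′)
  without-keeps β {S} {S′} S′≢S p with S′ ≟ₛ S
  ... | yes S′≡S = contradiction S′≡S S′≢S
  ... | no _     = p

  without-drops : ∀ β S → ¬ T (without β S S)
  without-drops β S p with S ≟ₛ S
  ... | yes _ = p
  ... | no S≢S = S≢S refl

  without-proper : ∀ β {S} → T (β S) → ProperSub (without β S) β
  without-proper β {S} βS = without-⊆ β S , S , βS , without-drops β S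

  samePlus-without : ∀ β S → (∀ {Z} → Stable (without β S) Z → S ⊆ Z → μ S ⊆ Z) →
    SamePlus μ (without β S) β
  samePlus-without β S fillS = samePlus-of-sameStable (without β S) β stable⇒ (λ stableZ S′ w → stableZ S′ (without-⊆ β S S′ w))
    where
    stable⇒ : ∀ {Z} → Stable (without β S) Z → Stable β Z
    stable⇒ stableZ S′ βS′ S′⊆Z with S′ ≟ₛ S
    ... | yes refl = fillS stableZ S′⊆Z
    ... | no S′≢S  = stableZ S′ (without-keeps β S′≢S βS′) S′⊆Z

  ∩-stable-without : ∀ β {S Z D} → Closed μ D → ¬ (μ S ⊆ D) → Stable (without β S) Z → Stable β (Z ∩ D)
  ∩-stable-without β {S} {Z} {D} closedD μS⊈D stableZ R βR R⊆Z∩D with R ≟ₛ S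
  ... | yes refl = ⊥-elim (μS⊈D (closure-least closedD R⊆D))
    where
    R⊆D : R ⊆ D
    R⊆D = ⊆-trans R⊆Z∩D (p∩q⊆q Z D)
  ... | no R≢S =
    ⊆-∩ (stableZ R (without-keeps β R≢S βR) (⊆-trans R⊆Z∩D (p∩q⊆p Z D)))
        (closure-least closedD (⊆-trans R⊆Z∩D (p∩q⊆q Z D)))

  ClosedBelow : Subset n → Subset n → Set
  ClosedBelow C Z = ∀ S → S ⊆ Z → μ S ⊆ C → μ S ≢ C → μ S ⊆ Z

  closedBelow⇒stable : ∀ {α C Z} → Closed μ C → TopEmpty μ α C → Z ⊆ C → ClosedBelow C Z → Stable α Z
  closedBelow⇒stable closedC topEmpty Z⊆C closedBelow S αS S⊆Z =
    closedBelow S S⊆Z (closure-least closedC (⊆-trans S⊆Z Z⊆C)) (topEmpty S αS)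

  without-closedBelow : ∀ {β S C Z} → IsCover μ β → μ S ≡ C → Stable (without β S) Z → ClosedBelow C (Z ∩ C)
  without-closedBelow {β} {S} {C} {Z} cover μS≡C stableZ S′ S′⊆Z∩C μS′⊆C μS′≢C =
    ⊆-∩ (⊆-trans μS′⊆Z∩μS′ (p∩q⊆p Z (μ S′))) μS′⊆C
    where
    μS⊈μS′ : ¬ (μ S ⊆ μ S′)
    μS⊈μS′ μS⊆μS′ = μS′≢C (⊆-antisym μS′⊆C (subst (_⊆ μ S′) μS≡C μS⊆μS′))

    μS′⊆Z∩μS′ : μ S′ ⊆ Z ∩ μ S′
    μS′⊆Z∩μS′ = cover⇒closure-least β cover (∩-stable-without β (idempotent S′) μS⊈μS′ stableZ)
                  (⊆-∩ (⊆-trans S′⊆Z∩C (p∩q⊆p Z C)) (extensive S′))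

  topEmpty-transfer : ∀ {α β C} → IsCover μ α → IsCover μ β → Nonredundant μ β → Closed μ C →
    TopEmpty μ α C → TopEmpty μ β C
  topEmpty-transfer {α} {β} {C} coverα coverβ nonredundant closedC topEmpty S βS μS≡C =
    nonredundant (without β S) (without-proper β βS) (samePlus-without β S μS⊆stable)
    where
    μS⊆stable : ∀ {Z} → Stable (without β S) Z → S ⊆ Z → μ S ⊆ Z
    μS⊆stable {Z} stableZ S⊆Z =
      ⊆-trans (cover⇒closure-least α coverα
                 (closedBelow⇒stable closedC topEmpty (p∩q⊆q Z C) (without-closedBelow coverβ μS≡C stableZ))
                 (⊆-∩ S⊆Z (subst (S ⊆_) μS≡C (extensive S))))
              (p∩q⊆p Z C)

mainTheorem9 : (n : ℕ) (μ : Subset n → Subset n) → IsClosureOperator μ →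
    (α β : SubRel n) →
    IsCover μ α → Nonredundant μ α →
    IsCover μ β → Nonredundant μ β →
    (C : Subset n) → Closed μ C →
    (TopEmpty μ α C → TopEmpty μ β C) × (TopEmpty μ β C → TopEmpty μ α C)
mainTheorem9 n μ closure α β coverα nonredundantα coverβ nonredundantβ C closedC =
  topEmpty-transfer coverα coverβ nonredundantβ closedC ,
  topEmpty-transfer coverβ coverα nonredundantα closedC
  where open ClosureCovers closure
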